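{- Every critically $k$-frustrated signed plane graph has at most $2k$ negative facial cycles. Moreover, if it has exactly $2k$ negative facial cycles, then these are all of its facial cycles.
   Context: A signed graph $(G,\sigma)$ is a finite graph $G$ with a signature $\sigma:E(G)\to\{+,-\}$; a cycle is negative if it contains an odd number of negative edges. Switching at a vertex $v$ multiplies the signs of all edges incident with $v$ by $-$. The frustration index $\ell(G,\sigma)$ is the minimum number of negative edges over all signatures obtained from $\sigma$ by sequences of switchings. $(G,\sigma)$ is critically $k$-frustrated if $\ell(G,\sigma)=k$ and $\ell(G-e,\sigma)=k-1$ for every edge $e$. A signed plane graph is a signed graph with a fixed planar embedding of its underlying graph; its facial cycles are the boundaries of its faces. -}

module Defs where

-- Signed plane graphs are represented by combinatorial maps (rotation systems):
--   darts Fin n, edge involution α (fixed-point free), vertex rotation σ,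
--   face permutation φ = σ ∘ α.  Vertices = σ-orbits, edges = α-orbits,
--   faces = φ-orbits.  Planarity = each component has genus 0, i.e. the
--   Euler relation V + F = E + 2·(number of components) holds.

open import Data.Nat using (ℕ; zero; suc; _+_; _*_; _≤_; _≤ᵇ_)
open import Data.Bool using (Bool; true; false; _∧_; _∨_; _xor_; not; if_then_else_)
open import Data.Fin using (Fin; toℕ)
open import Data.Fin.Properties using (_≟_)
open import Data.Fin.Permutation using (Permutation′; _⟨$⟩ʳ_)
open import Data.List using (List; map; foldr; allFin; upTo)
open import Data.Bool.ListAction using (any; all)
open import Data.Nat.ListAction using (sum)
open import Data.Product using (Σ; _×_; _,_)
open import Relation.Nullary.Decidable using (⌊_⌋)
open import Relation.Binary.PropositionalEquality using (_≡_; _≢_)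

-- A signed combinatorial map on n darts. sign d = true means the edge of d is negative.
record SignedMap : Set where
  field
    n         : ℕ
    α         : Permutation′ n
    σ         : Permutation′ n
    α-invol   : ∀ d → α ⟨$⟩ʳ (α ⟨$⟩ʳ d) ≡ d
    α-free    : ∀ d → α ⟨$⟩ʳ d ≢ d
    sign      : Fin n → Bool
    sign-edge : ∀ d → sign (α ⟨$⟩ʳ d) ≡ sign d

iter : {A : Set} → (A → A) → ℕ → A → A
iter f zero    x = x
iter f (suc k) x = f (iter f k x)

module _ (M : SignedMap) where
  open SignedMap M

  αf σf φf : Fin n → Fin n
  αf d = α ⟨$⟩ʳ d
  σf d = σ ⟨$⟩ʳ d
  φf d = σf (αf d)

  countB : (Fin n → Bool) → ℕ
  countB p = sum (map (λ d → if p d then 1 else 0) (allFin n))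

  inOrbit : (Fin n → Fin n) → Fin n → Fin n → Bool
  inOrbit f d e = any (λ k → ⌊ iter f k d ≟ e ⌋) (upTo n)

  orbitRep : (Fin n → Fin n) → Fin n → Bool
  orbitRep f d = all (λ k → toℕ d ≤ᵇ toℕ (iter f k d)) (upTo n)

  numVertices numEdges numFaces : ℕ
  numVertices = countB (orbitRep σf)
  numEdges    = countB (orbitRep αf)
  numFaces    = countB (orbitRep φf)

  reach : ℕ → Fin n → Fin n → Bool
  reach zero    d e = ⌊ d ≟ e ⌋
  reach (suc j) d e = reach j d e ∨
    any (λ x → reach j d x ∧ (⌊ σf x ≟ e ⌋ ∨ ⌊ αf x ≟ e ⌋)) (allFin n)

  compRep : Fin n → Bool
  compRep d = all (λ e → not (reach n d e) ∨ (toℕ d ≤ᵇ toℕ e)) (allFin n)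

  numComponents : ℕ
  numComponents = countB compRep

  IsPlane : Set
  IsPlane = numVertices + numFaces ≡ numEdges + 2 * numComponents

  -- switchings: a Boolean per vertex, i.e. constant on σ-orbits
  Switching : Set
  Switching = Σ (Fin n → Bool) (λ τ → ∀ d → τ (σf d) ≡ τ d)

  switchedSign : Switching → Fin n → Bool
  switchedSign (τ , _) d = sign d xor τ d xor τ (αf d)

  negEdges : (Fin n → Bool) → Switching → ℕ
  negEdges keep τ = countB (λ d → orbitRep αf d ∧ keep d ∧ switchedSign τ d)

  IsFrustrationIndex : (Fin n → Bool) → ℕ → Set
  IsFrustrationIndex keep k =
    Σ Switching (λ τ → negEdges keep τ ≡ k) × (∀ τ → k ≤ negEdges keep τ)

  allEdges : Fin n → Bool
  allEdges _ = true

  deleteEdge : Fin n → Fin n → Bool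
  deleteEdge d e = not (inOrbit αf d e)

  CriticallyFrustrated : ℕ → Set
  CriticallyFrustrated k =
    IsFrustrationIndex allEdges k ×
    (∀ d → Σ ℕ (λ j → suc j ≡ k × IsFrustrationIndex (deleteEdge d) j))

  faceNegative : Fin n → Bool
  faceNegative d = foldr (λ e acc → (inOrbit φf d e ∧ sign e) xor acc) false (allFin n)

  numNegativeFaces : ℕ
  numNegativeFaces = countB (λ d → orbitRep φf d ∧ faceNegative d)

module Submission where

-- Switching at a vertex flips an even number of edge traversals of every facial walk, so face
-- signs are switching-invariant; fix a switching τ with exactly k negative edges. Each negative
-- face then contains a dart of a negative edge; faces are disjoint and the k negative edges have
-- 2k darts, so at most 2k faces are negative, and if exactly 2k are, every negative dart lies on a
-- negative face. For any dart d, an optimal switching of G − e (e the edge of d) has at most k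
-- negative edges on G and makes e negative, so the face of d is negative.

open import Defs
open import Algebra.Bundles using (CommutativeRing)
import Algebra.Properties.CommutativeMonoid.Sum as CommutativeMonoidSum
open import Data.Bool using (Bool; true; false; T; not; _∧_; _xor_; if_then_else_)
open import Data.Bool.Properties
  using (T?; T-≡; T-∧; not-involutive; ∧-comm; ∧-assoc; ∧-distribˡ-xor;
         xor-∧-commutativeRing; xor-assoc; xor-comm; xor-same; xor-identityʳ)
open import Data.Empty using (⊥-elim)
open import Data.Fin using (Fin; zero; suc; toℕ)
open import Data.Fin.Properties
  using (_≟_; suc-injective; 0≢1+n; toℕ-injective; toℕ<n; pigeonhole)
open import Data.Fin.Permutation using (Permutation′; _⟨$⟩ʳ_; _⟨$⟩ˡ_; inverseˡ; _∘ₚ_)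
open import Data.List using (upTo)
import Data.List as List
open import Data.List.Properties using (map-tabulate)
import Data.List.Relation.Unary.All.Properties as All
import Data.List.Relation.Unary.Any.Properties as Any
open import Data.Nat using (ℕ; zero; suc; _+_; _*_; _∸_; _≤_; _<_; _≤ᵇ_; z≤n)
open import Data.Nat.DivMod using (_%_; _/_; m≡m%n+[m/n]*n; m%n<n)
open import Data.Nat.Properties
  using (module ≤-Reasoning; ≤-refl; ≤-reflexive; ≤-trans; ≤-antisym; ≤-total; ≤-pred; 1+n≰n;
         n<1+n; m≤m+n; m≤n+m; m+[n∸m]≡n; ≤ᵇ⇒≤; ≤⇒≤ᵇ; +-comm; +-suc; +-identityʳ; *-suc;
         +-mono-≤; +-monoˡ-≤; +-monoʳ-≤; *-monoʳ-≤; +-cancelˡ-≤; +-cancelʳ-≤;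
         +-0-commutativeMonoid)
open import Data.Product using (∃; _×_; _,_; proj₁; proj₂)
open import Data.Sum using (_⊎_; inj₁; inj₂; [_,_]′)
import Data.Vec.Functional as Vector
open import Function using (_∘_; id; Equivalence)
open import Level using (Level)
open import Relation.Nullary using (¬_; yes; no)
open import Relation.Nullary.Decidable using (⌊_⌋; toWitness; fromWitness)
open import Relation.Unary using (_⊆_)
open import Relation.Binary.PropositionalEquality
  using (_≡_; _≗_; refl; sym; trans; cong; cong₂; subst; module ≡-Reasoning)

private
  variable
    a b c : Level
    A : Set a
    B : Set b
    C : Set c
    m n : ℕ

foldr-tabulate : (g : A → B) (_∙_ : B → C → C) (z : C) (h : Fin n → A) →
                 List.foldr (λ x → g x ∙_) z (List.tabulate h) ≡ Vector.foldr _∙_ z (g ∘ h)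
foldr-tabulate {n = zero}  g _∙_ z h = refl
foldr-tabulate {n = suc n} g _∙_ z h = cong (g (h zero) ∙_) (foldr-tabulate g _∙_ z (h ∘ suc))

module ℕ-Sum = CommutativeMonoidSum +-0-commutativeMonoid
module ⊕-Sum = CommutativeMonoidSum (CommutativeRing.+-commutativeMonoid xor-∧-commutativeRing)

open ℕ-Sum using (sum; ∑-distrib-+; ∑-comm; sum-permute; sum-cong-≗; sum-replicate-zero)

∑-mono-≤ : {f g : Fin n → ℕ} → (∀ i → f i ≤ g i) → sum f ≤ sum g
∑-mono-≤ {n = zero}  f≤g = z≤n
∑-mono-≤ {n = suc n} f≤g = +-mono-≤ (f≤g zero) (∑-mono-≤ (f≤g ∘ suc))

∑-mono-≤-rigid : {f g : Fin n → ℕ} → (∀ i → f i ≤ g i) → sum g ≤ sum f →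
                 ∀ i → f i ≡ g i
∑-mono-≤-rigid {n = suc n} {f} {g} f≤g ∑g≤∑f = λ
  { zero    → ≤-antisym (f≤g zero) g₀≤f₀
  ; (suc i) → ∑-mono-≤-rigid (f≤g ∘ suc) ∑g′≤∑f′ i }
  where
  ∑f′ = sum (f ∘ suc)
  ∑g′ = sum (g ∘ suc)
  g₀≤f₀ : g zero ≤ f zero
  g₀≤f₀ = +-cancelʳ-≤ ∑g′ (g zero) (f zero)
            (≤-trans ∑g≤∑f (+-monoʳ-≤ (f zero) (∑-mono-≤ (f≤g ∘ suc))))
  ∑g′≤∑f′ : ∑g′ ≤ ∑f′
  ∑g′≤∑f′ = +-cancelˡ-≤ (g zero) ∑g′ ∑f′
              (≤-trans ∑g≤∑f (+-monoˡ-≤ ∑f′ (f≤g zero)))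

T-injective : ∀ {x y} → (T x → T y) → (T y → T x) → x ≡ y
T-injective {false} {false} _   _   = refl
T-injective {false} {true}  _   y⇒x = ⊥-elim (y⇒x _)
T-injective {true}  {false} x⇒y _   = ⊥-elim (x⇒y _)
T-injective {true}  {true}  _   _   = refl

indicator : Bool → ℕ
indicator b = if b then 1 else 0

indicator-T : ∀ {x} → T x → indicator x ≡ 1
indicator-T {true} _ = refl

indicator-¬T : ∀ {x} → ¬ T x → indicator x ≡ 0
indicator-¬T {false} _  = refl
indicator-¬T {true}  ¬t = ⊥-elim (¬t _)

indicator-mono : ∀ {x y} → (T x → T y) → indicator x ≤ indicator y
indicator-mono {false}        _   = z≤n
indicator-mono {true} {true}  _   = ≤-refl
indicator-mono {true} {false} x⇒y = ⊥-elim (x⇒y _)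

indicator-injective : ∀ {x y} → indicator x ≡ indicator y → x ≡ y
indicator-injective {false} {false} _ = refl
indicator-injective {true}  {true}  _ = refl

indicator-split : ∀ x y → indicator x ≡ indicator (x ∧ y) + indicator (x ∧ not y)
indicator-split false y     = refl
indicator-split true  true  = refl
indicator-split true  false = refl

count : (Fin n → Bool) → ℕ
count p = sum (indicator ∘ p)

module _ {p q : Fin n → Bool} where

  count-cong : p ≗ q → count p ≡ count q
  count-cong p≗q = sum-cong-≗ (cong indicator ∘ p≗q)

  count-mono : T ∘ p ⊆ T ∘ q → count p ≤ count q
  count-mono p⊆q = ∑-mono-≤ (λ i → indicator-mono (p⊆q {i}))

  count-mono-rigid : T ∘ p ⊆ T ∘ q → count q ≤ count p → T ∘ q ⊆ T ∘ p
  count-mono-rigid p⊆q q≤p {i} = subst T (indicator-injective (sym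
    (∑-mono-≤-rigid (λ j → indicator-mono (p⊆q {j})) q≤p i)))

count-none : {p : Fin n → Bool} → (∀ i → ¬ T (p i)) → count p ≡ 0
count-none {n} none = trans (sum-cong-≗ (indicator-¬T ∘ none)) (sum-replicate-zero n)

count-witness : {p : Fin n → Bool} (i : Fin n) → T (p i) → 1 ≤ count p
count-witness             zero    pᵢ = ≤-trans (≤-reflexive (sym (indicator-T pᵢ))) (m≤m+n _ _)
count-witness {p = p} (suc i) pᵢ = ≤-trans (count-witness i pᵢ) (m≤n+m _ (indicator (p zero)))

count-≤1 : {p : Fin n → Bool} → (∀ {i j} → T (p i) → T (p j) → i ≡ j) → count p ≤ 1
count-≤1 {n = zero}          unique = z≤n
count-≤1 {n = suc n} {p = p} unique with T? (p zero)
... | yes p₀ = ≤-reflexive (cong₂ _+_ (indicator-T p₀)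
                 (count-none {p = p ∘ suc} (λ i pᵢ → 0≢1+n (unique p₀ pᵢ))))
... | no ¬p₀ = ≤-trans (≤-reflexive (cong (_+ count (p ∘ suc)) (indicator-¬T ¬p₀)))
                       (count-≤1 (λ pᵢ pⱼ → suc-injective (unique pᵢ pⱼ)))

count-split : (p q : Fin n → Bool) →
              count p ≡ count (λ i → p i ∧ q i) + count (λ i → p i ∧ not (q i))
count-split p q = trans (sum-cong-≗ (λ i → indicator-split (p i) (q i)))
  (∑-distrib-+ (λ i → indicator (p i ∧ q i)) (λ i → indicator (p i ∧ not (q i))))

count-permute : (p : Fin n → Bool) (π : Permutation′ n) →
                count p ≡ count (p ∘ (π ⟨$⟩ʳ_))
count-permute p π = sum-permute (indicator ∘ p) π

count-pairs : (p r : Fin n → Bool) (π : Permutation′ n) →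
              (∀ i → p (π ⟨$⟩ʳ i) ≡ p i) → (∀ i → r (π ⟨$⟩ʳ i) ≡ not (r i)) →
              count p ≡ 2 * count (λ i → p i ∧ r i)
count-pairs p r π p-inv r-flip = begin
  count p                                       ≡⟨ count-split p r ⟩
  N + count (λ i → p i ∧ not (r i))             ≡⟨ cong (N +_) (count-permute _ π) ⟩
  N + count (λ i → p (π′ i) ∧ not (r (π′ i)))   ≡⟨ cong (N +_) (count-cong swapped) ⟩
  N + N                                         ≡⟨ cong (N +_) (sym (+-identityʳ N)) ⟩
  2 * N                                         ∎
  where
  open ≡-Reasoning
  π′ = π ⟨$⟩ʳ_
  N = count (λ i → p i ∧ r i)
  swapped : (λ i → p (π′ i) ∧ not (r (π′ i))) ≗ (λ i → p i ∧ r i)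
  swapped i = cong₂ _∧_ (p-inv i) (trans (cong not (r-flip i)) (not-involutive (r i)))

count-≤-by-witnesses : {p : Fin m → Bool} {q : Fin n → Bool} (R : Fin m → Fin n → Bool) →
  (∀ {i} → T (p i) → ∃ λ j → T (R i j) × T (q j)) →
  (∀ {i i′ j} → T (p i) → T (R i j) → T (p i′) → T (R i′ j) → i ≡ i′) →
  count p ≤ count q
count-≤-by-witnesses {p = p} {q} R witness unique = begin
  sum (λ i → indicator (p i))                  ≤⟨ ∑-mono-≤ witnessed ⟩
  sum (λ i → sum (λ j → indicator (P i j)))    ≡⟨ ∑-comm (λ i j → indicator (P i j)) ⟩
  sum (λ j → sum (λ i → indicator (P i j)))    ≤⟨ ∑-mono-≤ at-most-one ⟩
  sum (λ j → indicator (q j))                  ∎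
  where
  open ≤-Reasoning
  P : _ → _ → Bool
  P i j = p i ∧ R i j ∧ q j

  pack : ∀ {i j} → T (p i) → T (R i j) → T (q j) → T (P i j)
  pack pᵢ Rᵢⱼ qⱼ = Equivalence.from T-∧ (pᵢ , Equivalence.from T-∧ (Rᵢⱼ , qⱼ))

  unpack : ∀ {i j} → T (P i j) → T (p i) × T (R i j) × T (q j)
  unpack Pᵢⱼ = let pᵢ , RQ = Equivalence.to T-∧ Pᵢⱼ in pᵢ , Equivalence.to T-∧ RQ

  witnessed : ∀ i → indicator (p i) ≤ count (λ j → P i j)
  witnessed i with T? (p i)
  ... | no ¬pᵢ = ≤-trans (≤-reflexive (indicator-¬T ¬pᵢ)) z≤n
  ... | yes pᵢ = let j , Rᵢⱼ , qⱼ = witness pᵢ in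
    ≤-trans (≤-reflexive (indicator-T pᵢ)) (count-witness j (pack pᵢ Rᵢⱼ qⱼ))

  at-most-one : ∀ j → count (λ i → P i j) ≤ indicator (q j)
  at-most-one j with T? (q j)
  ... | no ¬qⱼ = ≤-reflexive (trans
    (count-none {p = λ i → P i j} (λ i Pᵢⱼ → ¬qⱼ (proj₂ (proj₂ (unpack Pᵢⱼ)))))
    (sym (indicator-¬T ¬qⱼ)))
  ... | yes qⱼ = ≤-trans (count-≤1 same-row) (≤-reflexive (sym (indicator-T qⱼ)))
    where
    same-row : ∀ {i i′} → T (P i j) → T (P i′ j) → i ≡ i′
    same-row Pᵢⱼ Pᵢ′ⱼ = let pᵢ , Rᵢⱼ , _ = unpack Pᵢⱼ ; pᵢ′ , Rᵢ′ⱼ , _ = unpack Pᵢ′ⱼ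
                        in unique pᵢ Rᵢⱼ pᵢ′ Rᵢ′ⱼ

⊕-sum-witness : (f : Fin n → Bool) → T (⊕-Sum.sum f) → ∃ λ i → T (f i)
⊕-sum-witness {n = suc n} f odd with f zero in f₀
... | true  = zero , subst T (sym f₀) _
... | false = let i , fᵢ = ⊕-sum-witness (f ∘ suc) odd in suc i , fᵢ

⊕-sum-coboundary : (π : Permutation′ n) (b g : Fin n → Bool) → (∀ i → b (π ⟨$⟩ʳ i) ≡ b i) →
                   ⊕-Sum.sum (λ i → b i ∧ (g i xor g (π ⟨$⟩ʳ i))) ≡ false
⊕-sum-coboundary π b g b-inv = begin
  ⊕-Sum.sum (λ i → b i ∧ (g i xor g (π′ i)))
    ≡⟨ ⊕-Sum.sum-cong-≗ (λ i → ∧-distribˡ-xor (b i) _ _) ⟩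
  ⊕-Sum.sum (λ i → (b i ∧ g i) xor (b i ∧ g (π′ i)))
    ≡⟨ ⊕-Sum.∑-distrib-+ (λ i → b i ∧ g i) (λ i → b i ∧ g (π′ i)) ⟩
  Σbg xor ⊕-Sum.sum (λ i → b i ∧ g (π′ i))
    ≡⟨ cong (Σbg xor_) (⊕-Sum.sum-cong-≗ (λ i → cong (_∧ g (π′ i)) (sym (b-inv i)))) ⟩
  Σbg xor ⊕-Sum.sum (λ i → b (π′ i) ∧ g (π′ i))
    ≡⟨ cong (Σbg xor_) (⊕-Sum.sum-permute (λ i → b i ∧ g i) π) ⟨
  Σbg xor Σbg
    ≡⟨ xor-same Σbg ⟩
  false ∎
  where
  open ≡-Reasoning
  π′ = π ⟨$⟩ʳ_
  Σbg = ⊕-Sum.sum (λ i → b i ∧ g i)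

module _ {A : Set} (f : A → A) where

  iter-+ : ∀ k l x → iter f (k + l) x ≡ iter f k (iter f l x)
  iter-+ zero    l x = refl
  iter-+ (suc k) l x = cong f (iter-+ k l x)

  iter-* : ∀ m p {x} → iter f p x ≡ x → iter f (m * p) x ≡ x
  iter-* zero    p     fixed = refl
  iter-* (suc m) p {x} fixed = begin
    iter f (p + m * p) x         ≡⟨ iter-+ p (m * p) x ⟩
    iter f p (iter f (m * p) x)  ≡⟨ cong (iter f p) (iter-* m p fixed) ⟩
    iter f p x                   ≡⟨ fixed ⟩
    x                            ∎
    where open ≡-Reasoning

  iter-injective : (∀ {x y} → f x ≡ f y → x ≡ y) →
                   ∀ k {x y} → iter f k x ≡ iter f k y → x ≡ y
  iter-injective f-inj zero    eq = eq
  iter-injective f-inj (suc k) eq = iter-injective f-inj k (f-inj eq)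

  iter-invariant : {B : Set} (g : A → B) → (∀ x → g (f x) ≡ g x) →
                   ∀ k x → g (iter f k x) ≡ g x
  iter-invariant g g-inv zero    x = refl
  iter-invariant g g-inv (suc k) x = trans (g-inv (iter f k x)) (iter-invariant g g-inv k x)

module Orbits (M : SignedMap) (π : Permutation′ (SignedMap.n M)) where

  private
    N = SignedMap.n M
    f : Fin N → Fin N
    f = π ⟨$⟩ʳ_

    f-injective : ∀ {x y} → f x ≡ f y → x ≡ y
    f-injective eq = trans (sym (inverseˡ π)) (trans (cong (π ⟨$⟩ˡ_) eq) (inverseˡ π))

  infix 4 _∼_
  _∼_ : Fin N → Fin N → Set
  d ∼ e = ∃ λ k → iter f k d ≡ e

  ∼-step : ∀ {d e} → d ∼ e → d ∼ f e
  ∼-step (k , eq) = suc k , cong f eq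

  ∼-trans : ∀ {d e x} → d ∼ e → e ∼ x → d ∼ x
  ∼-trans {d} (k , d→e) (l , e→x) =
    l + k , trans (iter-+ f l k d) (trans (cong (iter f l) d→e) e→x)

  period : ∀ d → ∃ λ q → suc q ≤ N × iter f (suc q) d ≡ d
  period d with pigeonhole (n<1+n N) (λ (i : Fin (suc N)) → iter f (toℕ i) d)
  ... | i , j , i<j , same = q , 1+q≤N , iter-injective f f-injective (toℕ i) returns
    where
    q = toℕ j ∸ suc (toℕ i)
    i+1+q≡j : toℕ i + suc q ≡ toℕ j
    i+1+q≡j = trans (+-suc (toℕ i) q) (m+[n∸m]≡n i<j)
    1+q≤N : suc q ≤ N
    1+q≤N = ≤-trans (m≤n+m (suc q) (toℕ i))
                    (≤-trans (≤-reflexive i+1+q≡j) (≤-pred (toℕ<n j)))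
    returns : iter f (toℕ i) (iter f (suc q) d) ≡ iter f (toℕ i) d
    returns = trans (sym (iter-+ f (toℕ i) (suc q) d))
                    (trans (cong (λ k → iter f k d) i+1+q≡j) (sym same))

  ∼-bounded : ∀ {d e} → d ∼ e → ∃ λ k → k < N × iter f k d ≡ e
  ∼-bounded {d} {e} (k , d→e) with period d
  ... | q , 1+q≤N , returns = k % suc q , ≤-trans (m%n<n k (suc q)) 1+q≤N , (begin
    iter f (k % suc q) d
      ≡⟨ cong (iter f (k % suc q)) (iter-* f (k / suc q) (suc q) returns) ⟨
    iter f (k % suc q) (iter f (k / suc q * suc q) d)
      ≡⟨ iter-+ f (k % suc q) (k / suc q * suc q) d ⟨
    iter f (k % suc q + k / suc q * suc q) d
      ≡⟨ cong (λ l → iter f l d) (m≡m%n+[m/n]*n k (suc q)) ⟨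
    iter f k d
      ≡⟨ d→e ⟩
    e ∎)
    where open ≡-Reasoning

  ∼-sym : ∀ {d e} → d ∼ e → e ∼ d
  ∼-sym {d} {e} (k , d→e) with period d
  ... | q , _ , returns = k * q , (begin
    iter f (k * q) e             ≡⟨ cong (iter f (k * q)) d→e ⟨
    iter f (k * q) (iter f k d)  ≡⟨ iter-+ f (k * q) k d ⟨
    iter f (k * q + k) d         ≡⟨ cong (λ l → iter f l d) k*q+k≡k*[1+q] ⟩
    iter f (k * suc q) d         ≡⟨ iter-* f k (suc q) returns ⟩
    d                            ∎)
    where
    open ≡-Reasoning
    k*q+k≡k*[1+q] : k * q + k ≡ k * suc q
    k*q+k≡k*[1+q] = trans (+-comm (k * q) k) (sym (*-suc k q))

  ∼-invariant : {B : Set} (g : Fin N → B) → (∀ x → g (f x) ≡ g x) →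
                ∀ {d e} → d ∼ e → g e ≡ g d
  ∼-invariant g g-inv {d} (k , refl) = iter-invariant f g g-inv k d

  inOrbit⇒∼ : ∀ {d e} → T (inOrbit M f d e) → d ∼ e
  inOrbit⇒∼ {d} {e} e∈ =
    let k , _ , hit = Any.applyUpTo⁻ id (Any.any⁻ (λ k → ⌊ iter f k d ≟ e ⌋) (upTo N) e∈)
    in k , toWitness hit

  ∼⇒inOrbit : ∀ {d e} → d ∼ e → T (inOrbit M f d e)
  ∼⇒inOrbit {d} {e} d∼e =
    let k , k<N , hit = ∼-bounded d∼e
    in Any.any⁺ (λ k → ⌊ iter f k d ≟ e ⌋) (Any.applyUpTo⁺ id (fromWitness hit) k<N)

  inOrbit-step : ∀ d e → inOrbit M f d (f e) ≡ inOrbit M f d e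
  inOrbit-step d e = T-injective
    (λ fe∈ → ∼⇒inOrbit (∼-trans (inOrbit⇒∼ fe∈) (∼-sym (1 , refl))))
    (∼⇒inOrbit ∘ ∼-step ∘ inOrbit⇒∼)

  inOrbit-∼ : ∀ {d e} → d ∼ e → ∀ x → inOrbit M f e x ≡ inOrbit M f d x
  inOrbit-∼ d∼e x = T-injective
    (λ x∈ → ∼⇒inOrbit (∼-trans d∼e (inOrbit⇒∼ x∈)))
    (λ x∈ → ∼⇒inOrbit (∼-trans (∼-sym d∼e) (inOrbit⇒∼ x∈)))

  orbitRep⇒ : ∀ {r} → T (orbitRep M f r) → ∀ k → toℕ r ≤ toℕ (iter f k r)
  orbitRep⇒ {r} isRep k with ∼-bounded (k , refl)
  ... | l , l<N , same = subst (λ x → toℕ r ≤ toℕ x) same (≤ᵇ⇒≤ (toℕ r) _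
    (All.applyUpTo⁻ id N (All.all⁺ (λ k → toℕ r ≤ᵇ toℕ (iter f k r)) (upTo N) isRep) l<N))

  orbitRep⇐ : ∀ {r} → (∀ k → toℕ r ≤ toℕ (iter f k r)) → T (orbitRep M f r)
  orbitRep⇐ {r} minimal =
    All.all⁻ (λ k → toℕ r ≤ᵇ toℕ (iter f k r)) (All.applyUpTo⁺₂ id N (≤⇒≤ᵇ ∘ minimal))

  orbitRep-unique : ∀ {r r′} → T (orbitRep M f r) → T (orbitRep M f r′) →
                    r ∼ r′ → r ≡ r′
  orbitRep-unique {r} {r′} isRep isRep′ r∼r′ with r∼r′ | ∼-sym r∼r′
  ... | k , r→r′ | l , r′→r = toℕ-injective (≤-antisym
    (subst (λ x → toℕ r ≤ toℕ x) r→r′ (orbitRep⇒ isRep k))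
    (subst (λ x → toℕ r′ ≤ toℕ x) r′→r (orbitRep⇒ isRep′ l)))

module _ (M : SignedMap) where
  open SignedMap M renaming (n to N)

  private
    φ : Permutation′ N
    φ = α ∘ₚ σ

  module Faces = Orbits M φ
  module Edges = Orbits M α

  countB≡count : (p : Fin N → Bool) → countB M p ≡ count p
  countB≡count p = trans (cong (List.foldr _+_ 0) (map-tabulate id (indicator ∘ p)))
                         (foldr-tabulate id _+_ 0 (indicator ∘ p))

  faceNegative≡⊕-sum : ∀ d → faceNegative M d ≡ ⊕-Sum.sum (λ e → inOrbit M (φf M) d e ∧ sign e)
  faceNegative≡⊕-sum d = foldr-tabulate (λ e → inOrbit M (φf M) d e ∧ sign e) _xor_ false id

  faceNegative-∼ : ∀ {d e} → d Faces.∼ e → faceNegative M e ≡ faceNegative M d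
  faceNegative-∼ {d} {e} d∼e = begin
    faceNegative M e
      ≡⟨ faceNegative≡⊕-sum e ⟩
    ⊕-Sum.sum (λ x → inOrbit M (φf M) e x ∧ sign x)
      ≡⟨ ⊕-Sum.sum-cong-≗ (λ x → cong (_∧ sign x) (Faces.inOrbit-∼ d∼e x)) ⟩
    ⊕-Sum.sum (λ x → inOrbit M (φf M) d x ∧ sign x)
      ≡⟨ faceNegative≡⊕-sum d ⟨
    faceNegative M d ∎
    where open ≡-Reasoning

  edgeRep : Fin N → Bool
  edgeRep = orbitRep M (αf M)

  iter-α : ∀ k d → iter (αf M) k d ≡ d ⊎ iter (αf M) k d ≡ αf M d
  iter-α zero    d = inj₁ refl
  iter-α (suc k) d with iter-α k d
  ... | inj₁ same    = inj₂ (cong (αf M) same)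
  ... | inj₂ swapped = inj₁ (trans (cong (αf M) swapped) (α-invol d))

  edgeRep⇒ : ∀ {d} → T (edgeRep d) → toℕ d ≤ toℕ (αf M d)
  edgeRep⇒ isRep = Edges.orbitRep⇒ isRep 1

  edgeRep⇐ : ∀ {d} → toℕ d ≤ toℕ (αf M d) → T (edgeRep d)
  edgeRep⇐ {d} d≤αd = Edges.orbitRep⇐ {d} λ k →
    [ (λ same → ≤-reflexive (cong toℕ (sym same)))
    , (λ swapped → subst (λ x → toℕ d ≤ toℕ x) (sym swapped) d≤αd)
    ]′ (iter-α k d)

  edgeRep-flip : ∀ d → edgeRep (αf M d) ≡ not (edgeRep d)
  edgeRep-flip d with edgeRep d in isRep | edgeRep (αf M d) in isRep′
  ... | true  | false = refl
  ... | false | true  = refl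
  ... | true  | true  = ⊥-elim (α-free d (toℕ-injective (≤-antisym
    (αd≤d (edgeRep⇒ (Equivalence.from T-≡ isRep′))) (edgeRep⇒ (Equivalence.from T-≡ isRep)))))
    where
    αd≤d : toℕ (αf M d) ≤ toℕ (αf M (αf M d)) → toℕ (αf M d) ≤ toℕ d
    αd≤d = subst (λ x → toℕ (αf M d) ≤ toℕ x) (α-invol d)
  ... | false | false = ⊥-elim
    ([ (λ d≤αd → subst T isRep (edgeRep⇐ d≤αd))
     , (λ αd≤d → subst T isRep′ (edgeRep⇐ (αd≤ααd αd≤d)))
     ]′ (≤-total (toℕ d) (toℕ (αf M d))))
    where
    αd≤ααd : toℕ (αf M d) ≤ toℕ d → toℕ (αf M d) ≤ toℕ (αf M (αf M d))
    αd≤ααd = subst (λ x → toℕ (αf M d) ≤ toℕ x) (sym (α-invol d))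

  module Switched (τ : Switching M) where

    private
      t = proj₁ τ
      s = switchedSign M τ

    switchedSign-α : ∀ d → s (αf M d) ≡ s d
    switchedSign-α d rewrite sign-edge d | α-invol d =
      cong (sign d xor_) (xor-comm (t (αf M d)) (t d))

    count-negativeDarts : count s ≡ 2 * negEdges M (allEdges M) τ
    count-negativeDarts = begin
      count s                             ≡⟨ count-pairs s edgeRep α switchedSign-α edgeRep-flip ⟩
      2 * count (λ d → s d ∧ edgeRep d)   ≡⟨ cong (2 *_) (count-cong (λ d → ∧-comm (s d) (edgeRep d))) ⟩
      2 * count (λ d → edgeRep d ∧ s d)   ≡⟨ cong (2 *_) (countB≡count _) ⟨
      2 * negEdges M (allEdges M) τ       ∎
      where open ≡-Reasoning

    faceNegative-switch : ∀ d → faceNegative M d ≡ ⊕-Sum.sum (λ e → inOrbit M (φf M) d e ∧ s e)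
    faceNegative-switch d = begin
      faceNegative M d                               ≡⟨ faceNegative≡⊕-sum d ⟩
      ⊕-Sum.sum (λ e → O e ∧ sign e)                 ≡⟨ ⊕-Sum.sum-cong-≗ (cong (O _ ∧_) ∘ unswitch) ⟩
      ⊕-Sum.sum (λ e → O e ∧ (s e xor δ e))          ≡⟨ ⊕-Sum.sum-cong-≗ distribute ⟩
      ⊕-Sum.sum (λ e → (O e ∧ s e) xor (O e ∧ δ e))  ≡⟨ ⊕-Sum.∑-distrib-+ (λ e → O e ∧ s e) _ ⟩
      Σs xor ⊕-Sum.sum (λ e → O e ∧ δ e)             ≡⟨ cong (Σs xor_) boundary ⟩
      Σs xor false                                   ≡⟨ xor-identityʳ Σs ⟩
      Σs                                             ∎
      where
      open ≡-Reasoning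
      O = inOrbit M (φf M) d
      δ : Fin N → Bool
      δ e = t e xor t (αf M e)
      Σs = ⊕-Sum.sum (λ e → O e ∧ s e)
      unswitch : ∀ e → sign e ≡ s e xor δ e
      unswitch e = sym (trans (xor-assoc (sign e) (δ e) (δ e))
                              (trans (cong (sign e xor_) (xor-same (δ e))) (xor-identityʳ (sign e))))
      distribute : ∀ e → O e ∧ (s e xor δ e) ≡ (O e ∧ s e) xor (O e ∧ δ e)
      distribute e = ∧-distribˡ-xor (O e) (s e) (δ e)
      -- τ is constant at vertices, so δ e = τ e xor τ (φ e).
      boundary : ⊕-Sum.sum (λ e → O e ∧ δ e) ≡ false
      boundary = trans
        (⊕-Sum.sum-cong-≗ (λ e → cong (λ x → O e ∧ (t e xor x)) (sym (proj₂ τ (αf M e)))))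
        (⊕-sum-coboundary φ O t (Faces.inOrbit-step d))

    negativeFace-has-negativeDart : ∀ {d} → T (faceNegative M d) →
                                    ∃ λ e → T (inOrbit M (φf M) d e) × T (s e)
    negativeFace-has-negativeDart {d} negative =
      let e , hit = ⊕-sum-witness _ (subst T (faceNegative-switch d) negative)
      in e , Equivalence.to T-∧ hit

    negativeFaceDart : Fin N → Bool
    negativeFaceDart e = s e ∧ faceNegative M e

    negativeFaceDart⇒negativeDart : T ∘ negativeFaceDart ⊆ T ∘ s
    negativeFaceDart⇒negativeDart = proj₁ ∘ Equivalence.to T-∧

    numNegativeFaces≤count-negativeFaceDart : numNegativeFaces M ≤ count negativeFaceDart
    numNegativeFaces≤count-negativeFaceDart = ≤-trans (≤-reflexive (countB≡count _))
      (count-≤-by-witnesses (inOrbit M (φf M)) witness unique)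
      where
      witness : ∀ {r} → T (orbitRep M (φf M) r ∧ faceNegative M r) →
                ∃ λ e → T (inOrbit M (φf M) r e) × T (negativeFaceDart e)
      witness {r} negativeRep =
        let negative = proj₂ (Equivalence.to T-∧ negativeRep)
            e , r∼e , sₑ = negativeFace-has-negativeDart negative
            faceₑ = subst T (sym (faceNegative-∼ (Faces.inOrbit⇒∼ r∼e))) negative
        in e , r∼e , Equivalence.from T-∧ (sₑ , faceₑ)
      unique : ∀ {r r′ e} →
               T (orbitRep M (φf M) r ∧ faceNegative M r) → T (inOrbit M (φf M) r e) →
               T (orbitRep M (φf M) r′ ∧ faceNegative M r′) → T (inOrbit M (φf M) r′ e) →
               r ≡ r′
      unique isRep r∼e isRep′ r′∼e = Faces.orbitRep-unique
        (proj₁ (Equivalence.to T-∧ isRep)) (proj₁ (Equivalence.to T-∧ isRep′))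
        (Faces.∼-trans (Faces.inOrbit⇒∼ r∼e) (Faces.∼-sym (Faces.inOrbit⇒∼ r′∼e)))

    numNegativeFaces≤2*negEdges : numNegativeFaces M ≤ 2 * negEdges M (allEdges M) τ
    numNegativeFaces≤2*negEdges = begin
      numNegativeFaces M             ≤⟨ numNegativeFaces≤count-negativeFaceDart ⟩
      count negativeFaceDart         ≤⟨ count-mono {q = s} negativeFaceDart⇒negativeDart ⟩
      count s                        ≡⟨ count-negativeDarts ⟩
      2 * negEdges M (allEdges M) τ  ∎
      where open ≤-Reasoning

    negativeDart⇒negativeFace : 2 * negEdges M (allEdges M) τ ≤ numNegativeFaces M →
                                ∀ {d} → T (s d) → T (faceNegative M d)
    negativeDart⇒negativeFace tight negative = proj₂ (Equivalence.to T-∧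
      (count-mono-rigid {q = s} negativeFaceDart⇒negativeDart s≤ negative))
      where
      open ≤-Reasoning
      s≤ : count s ≤ count negativeFaceDart
      s≤ = begin
        count s                        ≡⟨ count-negativeDarts ⟩
        2 * negEdges M (allEdges M) τ  ≤⟨ tight ⟩
        numNegativeFaces M             ≤⟨ numNegativeFaces≤count-negativeFaceDart ⟩
        count negativeFaceDart         ∎

    negativeRepOfEdge : Fin N → Fin N → Bool
    negativeRepOfEdge d e = (edgeRep e ∧ s e) ∧ inOrbit M (αf M) d e

    negEdges-deleteEdge : ∀ d → negEdges M (allEdges M) τ ≡
                          count (negativeRepOfEdge d) + negEdges M (deleteEdge M d) τ
    negEdges-deleteEdge d = begin
      negEdges M (allEdges M) τ
        ≡⟨ countB≡count _ ⟩
      count (λ e → edgeRep e ∧ s e)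
        ≡⟨ count-split _ (inOrbit M (αf M) d) ⟩
      count (negativeRepOfEdge d) + count (λ e → (edgeRep e ∧ s e) ∧ deleteEdge M d e)
        ≡⟨ cong (count (negativeRepOfEdge d) +_) (count-cong reorder) ⟩
      count (negativeRepOfEdge d) + count (λ e → edgeRep e ∧ deleteEdge M d e ∧ s e)
        ≡⟨ cong (count (negativeRepOfEdge d) +_) (countB≡count _) ⟨
      count (negativeRepOfEdge d) + negEdges M (deleteEdge M d) τ ∎
      where
      open ≡-Reasoning
      reorder : ∀ e → (edgeRep e ∧ s e) ∧ deleteEdge M d e ≡ edgeRep e ∧ deleteEdge M d e ∧ s e
      reorder e = trans (∧-assoc (edgeRep e) (s e) _) (cong (edgeRep e ∧_) (∧-comm (s e) _))

    count-negativeRepOfEdge-≤1 : ∀ d → count (negativeRepOfEdge d) ≤ 1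
    count-negativeRepOfEdge-≤1 d = count-≤1 λ hit hit′ →
      let (isRep , _) , d∼e = unpack hit ; (isRep′ , _) , d∼e′ = unpack hit′
      in Edges.orbitRep-unique isRep isRep′ (Edges.∼-trans (Edges.∼-sym d∼e) d∼e′)
      where
      unpack : ∀ {e} → T (negativeRepOfEdge d e) → (T (edgeRep e) × T (s e)) × d Edges.∼ e
      unpack hit = let repNeg , d∼e = Equivalence.to T-∧ hit
                   in Equivalence.to T-∧ repNeg , Edges.inOrbit⇒∼ d∼e

    count-negativeRepOfEdge-positive : ∀ {d} → ¬ T (s d) → count (negativeRepOfEdge d) ≡ 0
    count-negativeRepOfEdge-positive {d} positive = count-none {p = negativeRepOfEdge d} λ e hit →
      let repNeg , d∼e = Equivalence.to T-∧ hit
      in positive (subst T (Edges.∼-invariant s switchedSign-α (Edges.inOrbit⇒∼ d∼e))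
                           (proj₂ (Equivalence.to T-∧ repNeg)))

  -- An optimal switching of G - e, put back on G, makes e negative: otherwise G would have
  -- only k - 1 negative edges.
  criticalSwitching : ∀ {k} → CriticallyFrustrated M k → ∀ d →
                      ∃ λ τ → T (switchedSign M τ d) × negEdges M (allEdges M) τ ≤ k
  criticalSwitching {k} ((_ , minimal) , critical) d with critical d
  ... | j , 1+j≡k , ((τ , τ-attains-j) , _) with T? (switchedSign M τ d)
  ... | yes negative = τ , negative , (begin
    negEdges M (allEdges M) τ
      ≡⟨ negEdges-deleteEdge d ⟩
    count (negativeRepOfEdge d) + negEdges M (deleteEdge M d) τ
      ≤⟨ +-monoˡ-≤ _ (count-negativeRepOfEdge-≤1 d) ⟩
    suc (negEdges M (deleteEdge M d) τ)
      ≡⟨ cong suc τ-attains-j ⟩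
    suc j
      ≡⟨ 1+j≡k ⟩
    k ∎)
    where
    open Switched τ
    open ≤-Reasoning
  ... | no positive = ⊥-elim (1+n≰n (begin
    suc j
      ≡⟨ 1+j≡k ⟩
    k
      ≤⟨ minimal τ ⟩
    negEdges M (allEdges M) τ
      ≡⟨ negEdges-deleteEdge d ⟩
    count (negativeRepOfEdge d) + negEdges M (deleteEdge M d) τ
      ≡⟨ cong (_+ negEdges M (deleteEdge M d) τ) (count-negativeRepOfEdge-positive positive) ⟩
    negEdges M (deleteEdge M d) τ
      ≡⟨ τ-attains-j ⟩
    j ∎))
    where
    open Switched τ
    open ≤-Reasoning

mainTheorem5 : (M : SignedMap) (k : ℕ) → IsPlane M → CriticallyFrustrated M k →
    (numNegativeFaces M ≤ 2 * k) ×
    (numNegativeFaces M ≡ 2 * k → ∀ (d : Fin (SignedMap.n M)) → faceNegative M d ≡ true)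
mainTheorem5 M k _ frustrated@(((τ , τ-attains-k) , _) , _) = bound , saturation
  where
  bound : numNegativeFaces M ≤ 2 * k
  bound = subst (λ j → numNegativeFaces M ≤ 2 * j) τ-attains-k
                (Switched.numNegativeFaces≤2*negEdges M τ)

  saturation : numNegativeFaces M ≡ 2 * k → ∀ d → faceNegative M d ≡ true
  saturation tight d =
    let τ′ , negative , τ′≤k = criticalSwitching M frustrated d
    in Equivalence.to T-≡ (Switched.negativeDart⇒negativeFace M τ′
         (≤-trans (*-monoʳ-≤ 2 τ′≤k) (≤-reflexive (sym tight))) negative)
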